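{- Let $G$ and $G'$ be graphs on the same vertex set with $G'\subseteq G$, and let $s_1,s_2,\ell$ be positive integers such that for every set $S$ of vertices the following hold: (i) if $|S|<s_1+s_2+\ell$, then $|E(G[S])|<2s_2$; (ii) if $|S|=s_1$, then $|N_{G'}(S)|\ge s_2+\ell$. If $|V(G)|\ge \ell+s_1+s_2$, then $G'$ contains a path of length $\ell$ which is an induced path in $G$.
   Context: For a graph $H$ and a vertex set $S$, $N_H(S)$ denotes the external neighbourhood of $S$ in $H$: the set of vertices not in $S$ that have at least one neighbour (in $H$) in $S$. $G[S]$ is the subgraph of $G$ induced by $S$. The length of a path is its number of edges; a path is induced in $G$ if it is an induced subgraph of $G$. -}

module Defs where

open import Data.Nat using (ℕ; zero; suc; _<ᵇ_)
open import Data.Bool using (Bool; true; false; _∧_; not; if_then_else_)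
open import Data.Fin using (Fin; toℕ)
open import Data.Fin.Subset using (Subset; ∣_∣)
open import Data.Vec using (lookup; tabulate)
open import Data.List using (List; allFin; map; concatMap)
open import Data.Nat.ListAction using (sum)
open import Data.Bool.ListAction using (any)
open import Data.Sum using (_⊎_)
open import Data.Product using (_×_; _,_)
open import Relation.Binary.PropositionalEquality using (_≡_)

record Graph (n : ℕ) : Set where
  field
    adj   : Fin n → Fin n → Bool
    sym   : ∀ u v → adj u v ≡ adj v u
    irrfl : ∀ v → adj v v ≡ false
open Graph public

_⊆G_ : ∀ {n} → Graph n → Graph n → Set
H ⊆G G = ∀ u v → adj H u v ≡ true → adj G u v ≡ true

bit : Bool → ℕ
bit true  = 1
bit false = 0

edgesIn : ∀ {n} → Graph n → Subset n → ℕ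
edgesIn {n} G S =
  sum (concatMap (λ u → map (λ v →
        bit ((toℕ u <ᵇ toℕ v) ∧ lookup S u ∧ lookup S v ∧ adj G u v))
      (allFin n)) (allFin n))

-- External neighbourhood N_H(S): vertices outside S with a neighbour in S.
nbhd : ∀ {n} → Graph n → Subset n → Subset n
nbhd {n} H S =
  tabulate (λ v → not (lookup S v) ∧ any (λ u → lookup S u ∧ adj H u v) (allFin n))

IsPath : ∀ {n} → Graph n → (ℓ : ℕ) → (Fin (suc ℓ) → Fin n) → Set
IsPath H ℓ p =
  (∀ i j → p i ≡ p j → i ≡ j) ×
  (∀ i j → suc (toℕ i) ≡ toℕ j → adj H (p i) (p j) ≡ true)

IsInducedIn : ∀ {n} → Graph n → (ℓ : ℕ) → (Fin (suc ℓ) → Fin n) → Set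
IsInducedIn G ℓ p =
  ∀ i j → adj G (p i) (p j) ≡ true → (suc (toℕ i) ≡ toℕ j) ⊎ (suc (toℕ j) ≡ toℕ i)

module Submission where

-- Run a depth-first search that keeps a set D of dead vertices and a path P of G' induced in G,
-- maintaining the invariant that every G'-neighbour of D outside D ∪ P has two G-neighbours in D ∪ P.
-- The last vertex t of P is extended by a G'-neighbour outside D ∪ P with no other G-neighbour on P;
-- if there is none, t dies, and the invariant survives because each such neighbour is G-adjacent to t
-- and to another vertex of P.  Should D reach size s₁ while P has fewer than ℓ + 1 vertices, (ii) gives
-- at least s₂ + ℓ − |P| > s₂ neighbours of D off P; s₂ of them together with D ∪ P are fewer than
-- s₁ + s₂ + ℓ vertices spanning at least 2s₂ edges, contradicting (i).  So P reaches length ℓ first.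

open import Defs hiding (sym)
open import Data.Bool using (Bool; true; false; _∧_; _∨_; not)
open import Data.Bool.Properties
  using (T-≡; ∧-zeroʳ; ∨-zeroʳ; ∨-identityʳ; ∨-conicalˡ; ∨-conicalʳ; ∨-assoc; ¬-not)
  renaming (_≟_ to _≟ᵇ_)
open import Data.Empty using (⊥; ⊥-elim)
open import Data.Fin using (Fin; zero; suc; toℕ; _≟_)
open import Data.Fin.Properties using (toℕ-injective; any?; all?; ¬∀⟶∃¬)
open import Data.Fin.Subset using (Subset; ∣_∣)
open import Data.List as List using (List; []; _∷_; concatMap; allFin)
open import Data.List.Relation.Unary.Any using (satisfied)
open import Data.List.Relation.Unary.Any.Properties using (any⁻)
open import Data.Nat using (ℕ; zero; suc; _+_; _*_; _≤_; _<_; _≥_; z≤n; s≤s; _<ᵇ_)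
open import Data.Nat.ListAction using (sum)
open import Data.Nat.ListAction.Properties using (sum-++)
open import Data.Nat.Properties hiding (_≟_)
open import Data.Product using (Σ; ∃; ∃₂; _×_; _,_; proj₁; proj₂)
open import Data.Sum using (_⊎_; inj₁; inj₂)
open import Data.Vec using (Vec; []; _∷_; lookup; tabulate)
open import Data.Vec.Properties using (lookup∘tabulate)
open import Function using (_∘_; id; Equivalence)
open import Relation.Binary.PropositionalEquality
open import Relation.Nullary using (¬_; Dec; yes; no; does; _×-dec_; contradiction)

open import Algebra.Properties.CommutativeMonoid.Sum +-0-commutativeMonoid
  using (sum-syntax; sum-cong-≗; sum-replicate-zero; sum-remove; ∑-distrib-+; ∑-comm)
  renaming (sum to ∑)
open import Algebra.Properties.Semiring.Sum +-*-semiring using (*-distribˡ-sum)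

m+1+n≡o⇒m<o : ∀ {m n o} → m + suc n ≡ o → m < o
m+1+n≡o⇒m<o {m} {n} m+1+n≡o = m+n≤o⇒m≤o (suc m) (≤-reflexive (trans (sym (+-suc m n)) m+1+n≡o))

∑-mono-≤ : ∀ {n} {f g : Fin n → ℕ} → (∀ i → f i ≤ g i) → ∑[ i < n ] f i ≤ ∑[ i < n ] g i
∑-mono-≤ {zero}  _   = z≤n
∑-mono-≤ {suc n} f≤g = +-mono-≤ (f≤g zero) (∑-mono-≤ (f≤g ∘ suc))

term≤∑ : ∀ {n} (f : Fin n → ℕ) i → f i ≤ ∑[ j < n ] f j
term≤∑ {suc n} f i = subst (f i ≤_) (sym (sum-remove {i = i} f)) (m≤m+n _ _)

pair≤∑ : ∀ {n} (f : Fin n → ℕ) {i j} → i ≢ j → f i + f j ≤ ∑[ k < n ] f k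
pair≤∑ f {zero}  {zero}  i≢j = contradiction refl i≢j
pair≤∑ f {zero}  {suc j} _   = +-monoʳ-≤ (f zero) (term≤∑ (f ∘ suc) j)
pair≤∑ f {suc i} {zero}  _   = ≤-trans (≤-reflexive (+-comm (f (suc i)) (f zero))) (pair≤∑ f {zero} {suc i} λ ())
pair≤∑ f {suc i} {suc j} i≢j = ≤-trans (pair≤∑ (f ∘ suc) (i≢j ∘ cong suc)) (m≤n+m _ (f zero))

∑∑-symmetrise : ∀ {n} (f : Fin n → Fin n → ℕ) →
  2 * ∑[ u < n ] ∑[ v < n ] f u v ≡ ∑[ u < n ] ∑[ v < n ] (f u v + f v u)
∑∑-symmetrise {n} f = begin
  2 * F                                             ≡⟨ cong (F +_) (+-identityʳ F) ⟩
  F + F                                             ≡⟨ cong (F +_) (∑-comm f) ⟩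
  F + ∑[ u < n ] ∑[ v < n ] f v u                  ≡⟨ ∑-distrib-+ (λ u → ∑[ v < n ] f u v) _ ⟨
  ∑[ u < n ] (∑[ v < n ] f u v + ∑[ v < n ] f v u) ≡⟨ sum-cong-≗ (λ u → ∑-distrib-+ (f u) (λ v → f v u)) ⟨
  ∑[ u < n ] ∑[ v < n ] (f u v + f v u)            ∎
  where
  open ≡-Reasoning
  F = ∑[ u < n ] ∑[ v < n ] f u v

sum-map-tabulate : ∀ {n} {A : Set} (f : A → ℕ) (g : Fin n → A) →
  sum (List.map f (List.tabulate g)) ≡ ∑[ i < n ] f (g i)
sum-map-tabulate {zero}  f g = refl
sum-map-tabulate {suc n} f g = cong (f (g zero) +_) (sum-map-tabulate f (g ∘ suc))

sum-concatMap : ∀ {A : Set} (f : A → List ℕ) (xs : List A) →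
  sum (concatMap f xs) ≡ sum (List.map (sum ∘ f) xs)
sum-concatMap f []       = refl
sum-concatMap f (x ∷ xs) = trans (sum-++ (f x) _) (cong (sum (f x) +_) (sum-concatMap f xs))

infixr 6 _∪_
infix  4 _⊆_

_∪_ : ∀ {n} → (Fin n → Bool) → (Fin n → Bool) → Fin n → Bool
(P ∪ Q) x = P x ∨ Q x

⁅_⁆ : ∀ {n} → Fin n → Fin n → Bool
⁅ t ⁆ x = does (x ≟ t)

_⊆_ : ∀ {n} → (Fin n → Bool) → (Fin n → Bool) → Set
P ⊆ Q = ∀ x → P x ≡ true → Q x ≡ true

Disjoint : ∀ {n} → (Fin n → Bool) → (Fin n → Bool) → Set
Disjoint P Q = ∀ x → P x ≡ true → Q x ≡ false

true≢false : ∀ {b} → b ≡ true → b ≢ false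
true≢false refl ()

not≡true⇒≡false : ∀ {b} → not b ≡ true → b ≡ false
not≡true⇒≡false {false} _ = refl

∧-true⁻ : ∀ {a b} → a ∧ b ≡ true → a ≡ true × b ≡ true
∧-true⁻ {true} b≡true = refl , b≡true

p⊆p∪q : ∀ {n} (P Q : Fin n → Bool) → P ⊆ P ∪ Q
p⊆p∪q P Q x Px rewrite Px = refl

q⊆p∪q : ∀ {n} (P Q : Fin n → Bool) → Q ⊆ P ∪ Q
q⊆p∪q P Q x Qx rewrite Qx = ∨-zeroʳ (P x)

x∈p∪q⁻ : ∀ {n} (P Q : Fin n → Bool) x → (P ∪ Q) x ≡ true → P x ≡ true ⊎ Q x ≡ true
x∈p∪q⁻ P Q x P∪Qx with P x
... | true  = inj₁ refl
... | false = inj₂ P∪Qx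

x∈⁅x⁆ : ∀ {n} (t : Fin n) → ⁅ t ⁆ t ≡ true
x∈⁅x⁆ t with t ≟ t
... | yes _   = refl
... | no t≢t = contradiction refl t≢t

x∈⁅y⁆⇒x≡y : ∀ {n} {x t : Fin n} → ⁅ t ⁆ x ≡ true → x ≡ t
x∈⁅y⁆⇒x≡y {x = x} {t} x∈⁅t⁆ with x ≟ t
... | yes x≡t = x≡t

x≢y⇒x∉⁅y⁆ : ∀ {n} {x t : Fin n} → x ≢ t → ⁅ t ⁆ x ≡ false
x≢y⇒x∉⁅y⁆ {x = x} {t} x≢t with x ≟ t
... | yes x≡t = contradiction x≡t x≢t
... | no _    = refl

∪-monoʳ : ∀ {n} (P : Fin n → Bool) {Q R} → Q ⊆ R → P ∪ Q ⊆ P ∪ R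
∪-monoʳ P Q⊆R x P∪Qx with P x
... | true  = refl
... | false = Q⊆R x P∪Qx

count : ∀ {n} → (Fin n → Bool) → ℕ
count {n} P = ∑[ x < n ] bit (P x)

∣∣≡count : ∀ {n} (S : Subset n) → ∣ S ∣ ≡ count (lookup S)
∣∣≡count []          = refl
∣∣≡count (true ∷ S)  = cong suc (∣∣≡count S)
∣∣≡count (false ∷ S) = ∣∣≡count S

∣tabulate∣≡count : ∀ {n} (P : Fin n → Bool) → ∣ tabulate P ∣ ≡ count P
∣tabulate∣≡count P = trans (∣∣≡count (tabulate P)) (sum-cong-≗ (cong bit ∘ lookup∘tabulate P))

count-∅ : ∀ n → count {n} (λ _ → false) ≡ 0
count-∅ = sum-replicate-zero

count-⁅⁆ : ∀ {n} (t : Fin n) → count ⁅ t ⁆ ≡ 1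
count-⁅⁆ {suc n} zero    = cong suc (count-∅ n)
count-⁅⁆ {suc n} (suc t) = count-⁅⁆ t

count-mono : ∀ {n} {P Q : Fin n → Bool} → P ⊆ Q → count P ≤ count Q
count-mono P⊆Q = ∑-mono-≤ (λ x → bit-mono (P⊆Q x))
  where
  bit-mono : ∀ {b c} → (b ≡ true → c ≡ true) → bit b ≤ bit c
  bit-mono {false} _   = z≤n
  bit-mono {true}  b⇒c rewrite b⇒c refl = ≤-refl

count-∪ : ∀ {n} (P Q : Fin n → Bool) → count (P ∪ Q) ≤ count P + count Q
count-∪ P Q =
  ≤-trans (∑-mono-≤ (λ x → bit-∨ (P x) (Q x))) (≤-reflexive (∑-distrib-+ (bit ∘ P) (bit ∘ Q)))
  where
  bit-∨ : ∀ a b → bit (a ∨ b) ≤ bit a + bit b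
  bit-∨ true  _ = s≤s z≤n
  bit-∨ false _ = ≤-refl

count-∪-disjoint : ∀ {n} (P Q : Fin n → Bool) → Disjoint P Q → count (P ∪ Q) ≡ count P + count Q
count-∪-disjoint P Q P∩Q≡∅ =
  trans (sum-cong-≗ (λ x → bit-∨ (P∩Q≡∅ x))) (∑-distrib-+ (bit ∘ P) (bit ∘ Q))
  where
  bit-∨ : ∀ {a b} → (a ≡ true → b ≡ false) → bit (a ∨ b) ≡ bit a + bit b
  bit-∨ {false} _    = refl
  bit-∨ {true}  a⇒¬b rewrite a⇒¬b refl = refl

count<n⇒∃false : ∀ {n} (P : Fin n → Bool) → count P < n → ∃ λ x → P x ≡ false
count<n⇒∃false {suc n} P |P|<n with P zero in P₀
... | false = zero , P₀
... | true  with count<n⇒∃false (P ∘ suc) (≤-pred |P|<n)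
...   | x , Px = suc x , Px

∃⊆-ofCount : ∀ {n} (P : Fin n → Bool) k → k ≤ count P → ∃ λ Q → Q ⊆ P × count Q ≡ k
∃⊆-ofCount {n}     P zero    _     = (λ _ → false) , (λ _ ()) , count-∅ n
∃⊆-ofCount {suc n} P (suc k) k<|P| with P zero in P₀
... | true with ∃⊆-ofCount (P ∘ suc) k (≤-pred k<|P|)
...   | Q , Q⊆P , |Q| =
  (λ { zero → true ; (suc x) → Q x }) , (λ { zero _ → P₀ ; (suc x) → Q⊆P x }) , cong suc |Q|
∃⊆-ofCount {suc n} P (suc k) k<|P| | false with ∃⊆-ofCount (P ∘ suc) (suc k) k<|P|
...   | Q , Q⊆P , |Q| =
  (λ { zero → false ; (suc x) → Q x }) , (λ { zero () ; (suc x) → Q⊆P x }) , |Q|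

adj⇒≢ : ∀ {n} (G : Graph n) {u v} → adj G u v ≡ true → u ≢ v
adj⇒≢ G {u} uv refl = true≢false uv (irrfl G u)

increasingEdge : ∀ {n} → Graph n → Subset n → Fin n → Fin n → ℕ
increasingEdge G S u v = bit ((toℕ u <ᵇ toℕ v) ∧ lookup S u ∧ lookup S v ∧ adj G u v)

edgesIn≡∑∑ : ∀ {n} (G : Graph n) (S : Subset n) →
  edgesIn G S ≡ ∑[ u < n ] ∑[ v < n ] increasingEdge G S u v
edgesIn≡∑∑ {n} G S =
  trans (sum-concatMap row (allFin n))
    (trans (sum-map-tabulate (sum ∘ row) id) (sum-cong-≗ (λ u → sum-map-tabulate (increasingEdge G S u) id)))
  where
  row : Fin n → List ℕ
  row u = List.map (increasingEdge G S u) (allFin n)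

<ᵇ-split : ∀ x y b → (b ≡ true → x ≢ y) → bit ((x <ᵇ y) ∧ b) + bit ((y <ᵇ x) ∧ b) ≡ bit b
<ᵇ-split zero    zero    false _   = refl
<ᵇ-split zero    zero    true  x≢y = contradiction refl (x≢y refl)
<ᵇ-split zero    (suc y) b     _   = +-identityʳ (bit b)
<ᵇ-split (suc x) zero    b     _   = refl
<ᵇ-split (suc x) (suc y) b     x≢y = <ᵇ-split x y b (λ b≡true → x≢y b≡true ∘ cong suc)

2*edgesIn≡∑∑adj : ∀ {n} (G : Graph n) (S : Subset n) →
  2 * edgesIn G S ≡ ∑[ u < n ] ∑[ v < n ] bit (lookup S u ∧ lookup S v ∧ adj G u v)
2*edgesIn≡∑∑adj {n} G S =
  trans (cong (2 *_) (edgesIn≡∑∑ G S))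
    (trans (∑∑-symmetrise (increasingEdge G S)) (sum-cong-≗ (λ u → sum-cong-≗ (λ v → unordered u v))))
  where
  ∈S = lookup S
  swap : ∀ a b c → b ∧ a ∧ c ≡ a ∧ b ∧ c
  swap true  b c = refl
  swap false b c = ∧-zeroʳ b
  unordered : ∀ u v →
    bit ((toℕ u <ᵇ toℕ v) ∧ ∈S u ∧ ∈S v ∧ adj G u v) +
    bit ((toℕ v <ᵇ toℕ u) ∧ ∈S v ∧ ∈S u ∧ adj G v u) ≡ bit (∈S u ∧ ∈S v ∧ adj G u v)
  unordered u v rewrite Graph.sym G v u | swap (∈S u) (∈S v) (adj G u v) =
    <ᵇ-split (toℕ u) (toℕ v) _ (λ e → adj⇒≢ G (edge e) ∘ toℕ-injective)
    where
    edge : ∈S u ∧ ∈S v ∧ adj G u v ≡ true → adj G u v ≡ true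
    edge e with ∧-true⁻ {∈S u} e
    ... | _ , e′ = proj₂ (∧-true⁻ {∈S v} e′)

HasTwoNeighboursIn : ∀ {n} → Graph n → (Fin n → Bool) → Fin n → Set
HasTwoNeighboursIn {n} G A w =
  ∃₂ λ (a b : Fin n) → a ≢ b × A a ≡ true × A b ≡ true × adj G w a ≡ true × adj G w b ≡ true

HasTwoNeighboursIn-mono : ∀ {n} (G : Graph n) {A B : Fin n → Bool} {w} → A ⊆ B →
  HasTwoNeighboursIn G A w → HasTwoNeighboursIn G B w
HasTwoNeighboursIn-mono G A⊆B (a , b , a≢b , Aa , Ab , wa , wb) = a , b , a≢b , A⊆B a Aa , A⊆B b Ab , wa , wb

-- Double counting: every vertex of W sends at least two edges into A, and an edge of G[A ∪ W]
-- is sent at most once because W and A are disjoint.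
2*count≤edgesIn : ∀ {n} (G : Graph n) (A W : Fin n → Bool) → Disjoint W A →
  (∀ w → W w ≡ true → HasTwoNeighboursIn G A w) → 2 * count W ≤ edgesIn G (tabulate (A ∪ W))
2*count≤edgesIn {n} G A W W∩A≡∅ two = ≤-trans 2|W|≤B (*-cancelˡ-≤ 2 2B≤2e)
  where
  T = tabulate (A ∪ W)

  between : Fin n → Fin n → ℕ
  between u v = bit (W u ∧ A v ∧ adj G u v)

  B = ∑[ u < n ] ∑[ v < n ] between u v

  degree : ∀ u → 2 * bit (W u) ≤ ∑[ v < n ] bit (W u ∧ A v ∧ adj G u v)
  degree u with W u in Wu
  ... | false = z≤n
  ... | true with two u Wu
  ...   | a , b , a≢b , Aa , Ab , ua , ub =
    subst (_≤ ∑[ v < n ] bit (A v ∧ adj G u v))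
      (cong₂ (λ x y → bit x + bit y) (cong₂ _∧_ Aa ua) (cong₂ _∧_ Ab ub))
      (pair≤∑ (λ v → bit (A v ∧ adj G u v)) a≢b)

  2|W|≤B : 2 * count W ≤ B
  2|W|≤B = ≤-trans (≤-reflexive (*-distribˡ-sum 2 (bit ∘ W))) (∑-mono-≤ degree)

  bit-pair : ∀ wu wv au av e → (wu ≡ true → au ≡ false) → (wv ≡ true → av ≡ false) →
    bit (wu ∧ av ∧ e) + bit (wv ∧ au ∧ e) ≤ bit ((au ∨ wu) ∧ (av ∨ wv) ∧ e)
  bit-pair false false _     _     _ _  _  = z≤n
  bit-pair true  true  _     true  _ _  wv = contradiction (wv refl) λ ()
  bit-pair true  true  true  false _ wu _  = contradiction (wu refl) λ ()
  bit-pair true  true  false false _ _  _  = z≤n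
  bit-pair true  false au    av    _ _  _  rewrite ∨-zeroʳ au | ∨-identityʳ av = ≤-reflexive (+-identityʳ _)
  bit-pair false true  au    av    _ _  _  rewrite ∨-identityʳ au | ∨-zeroʳ av = ≤-refl

  pairwise : ∀ u v →
    bit (W u ∧ A v ∧ adj G u v) + bit (W v ∧ A u ∧ adj G v u) ≤ bit (lookup T u ∧ lookup T v ∧ adj G u v)
  pairwise u v rewrite lookup∘tabulate (A ∪ W) u | lookup∘tabulate (A ∪ W) v | Graph.sym G v u =
    bit-pair (W u) (W v) (A u) (A v) (adj G u v) (W∩A≡∅ u) (W∩A≡∅ v)

  2B≤2e : 2 * B ≤ 2 * edgesIn G T
  2B≤2e = begin
    2 * B                                                          ≡⟨ ∑∑-symmetrise between ⟩
    ∑[ u < n ] ∑[ v < n ] (between u v + between v u)              ≤⟨ ∑-mono-≤ (∑-mono-≤ ∘ pairwise) ⟩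
    ∑[ u < n ] ∑[ v < n ] bit (lookup T u ∧ lookup T v ∧ adj G u v) ≡⟨ 2*edgesIn≡∑∑adj G T ⟨
    2 * edgesIn G T                                                ∎
    where open ≤-Reasoning

∈nbhd⁻ : ∀ {n} (H : Graph n) (S : Subset n) {w} → lookup (nbhd H S) w ≡ true →
  lookup S w ≡ false × ∃ λ d → lookup S d ≡ true × adj H d w ≡ true
∈nbhd⁻ {n} H S {w} w∈N with ∧-true⁻ {not (lookup S w)} (trans (sym (lookup∘tabulate _ w)) w∈N)
... | w∉S , hasNeighbour with satisfied (any⁻ _ (allFin n) (Equivalence.from T-≡ hasNeighbour))
...   | d , d∈S∧dw = not≡true⇒≡false w∉S , d , ∧-true⁻ (Equivalence.to T-≡ d∈S∧dw)

module DepthFirstSearch {n} (G G' : Graph n) (G'⊆G : G' ⊆G G) where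

  onPath : ∀ {k} → Vec (Fin n) k → Fin n → Bool
  onPath []       x = false
  onPath (y ∷ ys) x = (⁅ y ⁆ ∪ onPath ys) x

  onPath-lookup : ∀ {k} (xs : Vec (Fin n) k) i → onPath xs (lookup xs i) ≡ true
  onPath-lookup (y ∷ ys) zero    = p⊆p∪q ⁅ y ⁆ (onPath ys) y (x∈⁅x⁆ y)
  onPath-lookup (y ∷ ys) (suc i) = q⊆p∪q ⁅ y ⁆ (onPath ys) _ (onPath-lookup ys i)

  ∉onPath⇒≢lookup : ∀ {k x} (xs : Vec (Fin n) k) → onPath xs x ≡ false → ∀ i → x ≢ lookup xs i
  ∉onPath⇒≢lookup xs x∉xs i refl = true≢false (onPath-lookup xs i) x∉xs

  count-onPath : ∀ {k} (xs : Vec (Fin n) k) → count (onPath xs) ≤ k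
  count-onPath []       = ≤-reflexive (count-∅ n)
  count-onPath (y ∷ ys) = begin
    count (⁅ y ⁆ ∪ onPath ys)        ≤⟨ count-∪ ⁅ y ⁆ (onPath ys) ⟩
    count ⁅ y ⁆ + count (onPath ys)  ≡⟨ cong (_+ count (onPath ys)) (count-⁅⁆ y) ⟩
    suc (count (onPath ys))          ≤⟨ s≤s (count-onPath ys) ⟩
    suc _                            ∎
    where open ≤-Reasoning

  -- The path is stored with its most recently added end first.
  data InducedPath : ∀ {k} → Vec (Fin n) k → Set where
    empty  : InducedPath []
    single : ∀ v → InducedPath (v ∷ [])
    extend : ∀ {k w v} {ps : Vec (Fin n) k} → InducedPath (v ∷ ps) → adj G' v w ≡ true →
             onPath (v ∷ ps) w ≡ false → (∀ i → adj G w (lookup ps i) ≡ false) →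
             InducedPath (w ∷ v ∷ ps)

  InducedPath-tail : ∀ {k t} {ps : Vec (Fin n) k} → InducedPath (t ∷ ps) → InducedPath ps
  InducedPath-tail (single _)           = empty
  InducedPath-tail (extend vps _ _ _)   = vps

  head∉tail : ∀ {k t} {ps : Vec (Fin n) k} → InducedPath (t ∷ ps) → onPath ps t ≡ false
  head∉tail (single _)          = refl
  head∉tail (extend _ _ w∉vps _) = w∉vps

  lookup-injective : ∀ {k} {xs : Vec (Fin n) k} → InducedPath xs → ∀ i j → lookup xs i ≡ lookup xs j → i ≡ j
  lookup-injective _                    zero    zero    _   = refl
  lookup-injective (extend {v = v} {ps} _ _ w∉vps _) zero (suc j) w≡ =
    ⊥-elim (∉onPath⇒≢lookup (v ∷ ps) w∉vps j w≡)
  lookup-injective (extend {v = v} {ps} _ _ w∉vps _) (suc i) zero ≡w =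
    ⊥-elim (∉onPath⇒≢lookup (v ∷ ps) w∉vps i (sym ≡w))
  lookup-injective (extend vps _ _ _)   (suc i) (suc j) e  = cong suc (lookup-injective vps i j e)

  consecutive⇒adjacent : ∀ {k} {xs : Vec (Fin n) k} → InducedPath xs →
    ∀ i j → suc (toℕ i) ≡ toℕ j → adj G' (lookup xs i) (lookup xs j) ≡ true
  consecutive⇒adjacent (single _)           zero    zero          ()
  consecutive⇒adjacent (extend {w = w} {v} _ vw _ _) zero (suc zero) _ = trans (Graph.sym G' w v) vw
  consecutive⇒adjacent (extend vps _ _ _)   (suc i) (suc j)       e  =
    consecutive⇒adjacent vps i j (suc-injective e)

  adjacent⇒consecutive : ∀ {k} {xs : Vec (Fin n) k} → InducedPath xs →
    ∀ i j → adj G (lookup xs i) (lookup xs j) ≡ true → suc (toℕ i) ≡ toℕ j ⊎ suc (toℕ j) ≡ toℕ i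
  adjacent⇒consecutive _                    zero          zero          e = ⊥-elim (adj⇒≢ G e refl)
  adjacent⇒consecutive (extend _ _ _ _)     zero          (suc zero)    _ = inj₁ refl
  adjacent⇒consecutive (extend _ _ _ _)     (suc zero)    zero          _ = inj₂ refl
  adjacent⇒consecutive (extend _ _ _ w≁ps)  zero          (suc (suc j)) e = ⊥-elim (true≢false e (w≁ps j))
  adjacent⇒consecutive (extend {w = w} _ _ _ w≁ps) (suc (suc i)) zero e =
    ⊥-elim (true≢false (trans (Graph.sym G w _) e) (w≁ps i))
  adjacent⇒consecutive (extend vps _ _ _)   (suc i)       (suc j)       e with adjacent⇒consecutive vps i j e
  ... | inj₁ i→j = inj₁ (cong suc i→j)
  ... | inj₂ j→i = inj₂ (cong suc j→i)

  InducedPathOfLength : ℕ → Set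
  InducedPathOfLength ℓ = Σ (Fin (suc ℓ) → Fin n) λ p → IsPath G' ℓ p × IsInducedIn G ℓ p

  toInducedPathOfLength : ∀ {ℓ} {xs : Vec (Fin n) (suc ℓ)} → InducedPath xs → InducedPathOfLength ℓ
  toInducedPathOfLength {xs = xs} ip =
    lookup xs , (lookup-injective ip , consecutive⇒adjacent ip) , adjacent⇒consecutive ip

  Blocked : ∀ {k} → (Fin n → Bool) → Vec (Fin n) k → Set
  Blocked D P = ∀ d w → D d ≡ true → adj G' d w ≡ true → D w ≡ false → onPath P w ≡ false →
    HasTwoNeighboursIn G (D ∪ onPath P) w

  record Invariant {k} (D : Fin n → Bool) (P : Vec (Fin n) k) : Set where
    field
      induced : InducedPath P
      alive   : Disjoint (onPath P) D
      blocked : Blocked D P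
  open Invariant

  initial : Invariant (λ _ → false) []
  initial = record { induced = empty ; alive = λ _ () ; blocked = λ _ _ () }

  push : ∀ {k D w} {P : Vec (Fin n) k} → Invariant D P → InducedPath (w ∷ P) → D w ≡ false →
         Invariant D (w ∷ P)
  push {D = D} {w} {P} inv wP w∉D = record { induced = wP ; alive = alive′ ; blocked = blocked′ }
    where
    alive′ : Disjoint (onPath (w ∷ P)) D
    alive′ x x∈wP with x∈p∪q⁻ ⁅ w ⁆ (onPath P) x x∈wP
    ... | inj₁ x≡w = subst (λ y → D y ≡ false) (sym (x∈⁅y⁆⇒x≡y {x = x} {w} x≡w)) w∉D
    ... | inj₂ x∈P = alive inv x x∈P

    blocked′ : Blocked D (w ∷ P)
    blocked′ d u d∈D du u∉D u∉wP =
      HasTwoNeighboursIn-mono G (∪-monoʳ D (q⊆p∪q ⁅ w ⁆ (onPath P)))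
        (blocked inv d u d∈D du u∉D (∨-conicalʳ _ _ u∉wP))

  Extension : ∀ {k} → (Fin n → Bool) → Fin n → Vec (Fin n) k → Fin n → Set
  Extension D t ps w =
    adj G' t w ≡ true × D w ≡ false × onPath (t ∷ ps) w ≡ false × (∀ i → adj G w (lookup ps i) ≡ false)

  extension? : ∀ {k} D t (ps : Vec (Fin n) k) → Dec (∃ (Extension D t ps))
  extension? D t ps = any? λ w →
    adj G' t w ≟ᵇ true ×-dec D w ≟ᵇ false ×-dec onPath (t ∷ ps) w ≟ᵇ false ×-dec
    all? (λ i → adj G w (lookup ps i) ≟ᵇ false)

  module _ {k D t} {ps : Vec (Fin n) k} (inv : Invariant D (t ∷ ps)) (stuck : ¬ ∃ (Extension D t ps)) where

    private
      t∉D : D t ≡ false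
      t∉D = alive inv t (p⊆p∪q ⁅ t ⁆ (onPath ps) t (x∈⁅x⁆ t))

      t∉ps : onPath ps t ≡ false
      t∉ps = head∉tail (induced inv)

      ps-avoids-t : ∀ {x} → onPath ps x ≡ true → x ≢ t
      ps-avoids-t x∈ps refl = true≢false x∈ps t∉ps

      D∩⁅t⁆≡∅ : Disjoint D ⁅ t ⁆
      D∩⁅t⁆≡∅ x x∈D = x≢y⇒x∉⁅y⁆ {x = x} {t} λ { refl → true≢false x∈D t∉D }

      alive⁻ : ∀ {w} → (D ∪ ⁅ t ⁆) w ≡ false → onPath ps w ≡ false →
        D w ≡ false × onPath (t ∷ ps) w ≡ false
      alive⁻ w∉D′ w∉ps = ∨-conicalˡ _ _ w∉D′ , cong₂ _∨_ (∨-conicalʳ _ _ w∉D′) w∉ps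

      touchesTail : ∀ {w} → adj G' t w ≡ true → D w ≡ false → onPath (t ∷ ps) w ≡ false →
        ∃ λ i → adj G w (lookup ps i) ≡ true
      touchesTail {w} tw w∉D w∉P with all? (λ i → adj G w (lookup ps i) ≟ᵇ false)
      ... | yes w≁ps = contradiction (w , tw , w∉D , w∉P , w≁ps) stuck
      ... | no ¬w≁ps with ¬∀⟶∃¬ k _ (λ i → adj G w (lookup ps i) ≟ᵇ false) ¬w≁ps
      ...   | i , w~i = i , ¬-not w~i

    retreat : Invariant (D ∪ ⁅ t ⁆) ps
    retreat = record { induced = InducedPath-tail (induced inv) ; alive = alive′ ; blocked = blocked′ }
      where
      alive′ : Disjoint (onPath ps) (D ∪ ⁅ t ⁆)
      alive′ x x∈ps = cong₂ _∨_ (alive inv x (q⊆p∪q ⁅ t ⁆ (onPath ps) x x∈ps))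
                                (x≢y⇒x∉⁅y⁆ {x = x} {t} (ps-avoids-t x∈ps))

      blockedByT : ∀ {w} → adj G' t w ≡ true → D w ≡ false → onPath (t ∷ ps) w ≡ false →
        HasTwoNeighboursIn G ((D ∪ ⁅ t ⁆) ∪ onPath ps) w
      blockedByT {w} tw w∉D w∉P with touchesTail tw w∉D w∉P
      ... | i , w~i =
        t , lookup ps i , ∉onPath⇒≢lookup ps t∉ps i ,
        p⊆p∪q (D ∪ ⁅ t ⁆) (onPath ps) t (q⊆p∪q D ⁅ t ⁆ t (x∈⁅x⁆ t)) ,
        q⊆p∪q (D ∪ ⁅ t ⁆) (onPath ps) _ (onPath-lookup ps i) ,
        trans (Graph.sym G w t) (G'⊆G t w tw) , w~i

      blocked′ : Blocked (D ∪ ⁅ t ⁆) ps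
      blocked′ d w d∈D′ dw w∉D′ w∉ps with x∈p∪q⁻ D ⁅ t ⁆ d d∈D′ | alive⁻ w∉D′ w∉ps
      ... | inj₁ d∈D   | w∉D , w∉tps =
        HasTwoNeighboursIn-mono G (λ x → trans (∨-assoc (D x) _ _)) (blocked inv d w d∈D dw w∉D w∉tps)
      ... | inj₂ d∈⁅t⁆ | w∉D , w∉tps with x∈⁅y⁆⇒x≡y {x = d} {t} d∈⁅t⁆
      ...   | refl = blockedByT dw w∉D w∉tps

    count-retreat : count (D ∪ ⁅ t ⁆) ≡ suc (count D)
    count-retreat = begin
      count (D ∪ ⁅ t ⁆)        ≡⟨ count-∪-disjoint D ⁅ t ⁆ D∩⁅t⁆≡∅ ⟩
      count D + count ⁅ t ⁆    ≡⟨ cong (count D +_) (count-⁅⁆ t) ⟩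
      count D + 1              ≡⟨ +-comm (count D) 1 ⟩
      suc (count D)            ∎
      where open ≡-Reasoning

  freeNeighbours : ∀ {k} → (Fin n → Bool) → Vec (Fin n) k → Fin n → Bool
  freeNeighbours D P x = lookup (nbhd G' (tabulate D)) x ∧ not (onPath P x)

  freeNeighbour-blocked : ∀ {k D} {P : Vec (Fin n) k} → Blocked D P → ∀ w → freeNeighbours D P w ≡ true →
    (D ∪ onPath P) w ≡ false × HasTwoNeighboursIn G (D ∪ onPath P) w
  freeNeighbour-blocked {D = D} blk w w-free with ∧-true⁻ w-free
  ... | w∈N , not-w∈P with ∈nbhd⁻ G' (tabulate D) w∈N | not≡true⇒≡false not-w∈P
  ...   | w∉S , d , d∈S , dw | w∉P = cong₂ _∨_ w∉D w∉P , blk d w d∈D dw w∉D w∉P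
    where
    w∉D : D w ≡ false
    w∉D = trans (sym (lookup∘tabulate D w)) w∉S
    d∈D : D d ≡ true
    d∈D = trans (sym (lookup∘tabulate D d)) d∈S

  nbhd⊆free∪path : ∀ {k D} (P : Vec (Fin n) k) →
    lookup (nbhd G' (tabulate D)) ⊆ freeNeighbours D P ∪ onPath P
  nbhd⊆free∪path P x x∈N with onPath P x
  ... | true  = ∨-zeroʳ _
  ... | false rewrite x∈N = refl

  module _ (s₁ s₂ ℓ : ℕ) (s₁≤n : s₁ ≤ n)
    (sparse : ∀ (S : Subset n) → ∣ S ∣ < s₁ + s₂ + ℓ → edgesIn G S < 2 * s₂)
    (expanding : ∀ (S : Subset n) → ∣ S ∣ ≡ s₁ → ∣ nbhd G' S ∣ ≥ s₂ + ℓ) where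

    many-freeNeighbours : ∀ {k D} (P : Vec (Fin n) k) → count D ≡ s₁ → k ≤ ℓ →
      s₂ ≤ count (freeNeighbours D P)
    many-freeNeighbours {D = D} P |D|≡s₁ k≤ℓ = +-cancelʳ-≤ ℓ s₂ (count free) (begin
      s₂ + ℓ                                 ≤⟨ expanding (tabulate D) (trans (∣tabulate∣≡count D) |D|≡s₁) ⟩
      ∣ nbhd G' (tabulate D) ∣               ≡⟨ ∣∣≡count (nbhd G' (tabulate D)) ⟩
      count (lookup (nbhd G' (tabulate D)))  ≤⟨ count-mono (nbhd⊆free∪path P) ⟩
      count (free ∪ onPath P)                ≤⟨ count-∪ free (onPath P) ⟩
      count free + count (onPath P)          ≤⟨ +-monoʳ-≤ (count free) (≤-trans (count-onPath P) k≤ℓ) ⟩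
      count free + ℓ                         ∎)
      where
      open ≤-Reasoning
      free = freeNeighbours D P

    ∣D∪P∪W∣< : ∀ {k D W} (P : Vec (Fin n) k) → count D ≡ s₁ → count W ≡ s₂ → k < ℓ →
      ∣ tabulate ((D ∪ onPath P) ∪ W) ∣ < s₁ + s₂ + ℓ
    ∣D∪P∪W∣< {D = D} {W} P |D|≡s₁ |W|≡s₂ k<ℓ = begin-strict
      ∣ tabulate ((D ∪ onPath P) ∪ W) ∣    ≡⟨ ∣tabulate∣≡count ((D ∪ onPath P) ∪ W) ⟩
      count ((D ∪ onPath P) ∪ W)          ≤⟨ count-∪ (D ∪ onPath P) W ⟩
      count (D ∪ onPath P) + count W      ≤⟨ +-monoˡ-≤ (count W) (count-∪ D (onPath P)) ⟩
      count D + p + count W               ≡⟨ cong₂ (λ x y → x + p + y) |D|≡s₁ |W|≡s₂ ⟩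
      s₁ + p + s₂                         ≡⟨ +-assoc s₁ p s₂ ⟩
      s₁ + (p + s₂)                       ≡⟨ cong (s₁ +_) (+-comm p s₂) ⟩
      s₁ + (s₂ + p)                       ≡⟨ +-assoc s₁ s₂ p ⟨
      s₁ + s₂ + p                         <⟨ +-monoʳ-< (s₁ + s₂) (≤-<-trans (count-onPath P) k<ℓ) ⟩
      s₁ + s₂ + ℓ                         ∎
      where
      open ≤-Reasoning
      p = count (onPath P)

    blocked⇒⊥ : ∀ {k D} {P : Vec (Fin n) k} → Blocked D P → count D ≡ s₁ → k < ℓ → ⊥
    blocked⇒⊥ {D = D} {P} blk |D|≡s₁ k<ℓ
      with ∃⊆-ofCount (freeNeighbours D P) s₂ (many-freeNeighbours P |D|≡s₁ (<⇒≤ k<ℓ))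
    ... | W , W⊆free , |W|≡s₂ =
      <⇒≱ (sparse T (∣D∪P∪W∣< P |D|≡s₁ |W|≡s₂ k<ℓ))
        (subst (λ c → 2 * c ≤ edgesIn G T) |W|≡s₂
          (2*count≤edgesIn G (D ∪ onPath P) W
            (λ w w∈W → proj₁ (freeNeighbour-blocked {P = P} blk w (W⊆free w w∈W)))
            (λ w w∈W → proj₂ (freeNeighbour-blocked {P = P} blk w (W⊆free w w∈W)))))
      where
      T = tabulate ((D ∪ onPath P) ∪ W)

    -- a + 1 more vertices may still die and b + 1 more may still be pushed before the path has ℓ + 1 vertices.
    mutual
      search : ∀ a b {k D} {P : Vec (Fin n) k} → Invariant D P →
               count D + suc a ≡ s₁ → k + suc b ≡ suc ℓ → InducedPathOfLength ℓ
      search a b {D = D} {[]} inv |D| |P| with count<n⇒∃false D (≤-trans (m+1+n≡o⇒m<o |D|) s₁≤n)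
      ... | v , v∉D = advance a b (push inv (single v) v∉D) |D| |P|
      search a b {k} {D} {t ∷ ps} inv |D| |P| with extension? D t ps
      ... | yes (w , tw , w∉D , w∉P , w≁ps) =
        advance a b (push inv (extend (induced inv) tw w∉P w≁ps) w∉D) |D| (trans (sym (+-suc k b)) |P|)
      search zero    b {suc k} {D} {t ∷ ps} inv |D| |P| | no stuck =
        ⊥-elim (blocked⇒⊥ {P = ps} (blocked (retreat inv stuck))
                  (trans (count-retreat inv stuck) (trans (+-comm 1 (count D)) |D|))
                  (m+1+n≡o⇒m<o (suc-injective |P|)))
      search (suc a) b {suc k} {D} {t ∷ ps} inv |D| |P| | no stuck =
        search a (suc b) (retreat inv stuck)
          (trans (cong (_+ suc a) (count-retreat inv stuck)) (trans (sym (+-suc (count D) (suc a))) |D|))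
          (trans (+-suc k (suc b)) |P|)

      advance : ∀ a b {k D} {P : Vec (Fin n) (suc k)} → Invariant D P →
                count D + suc a ≡ s₁ → suc k + b ≡ suc ℓ → InducedPathOfLength ℓ
      advance a zero    {k} inv _ |P| =
        subst InducedPathOfLength (trans (sym (+-identityʳ k)) (suc-injective |P|))
          (toInducedPathOfLength (induced inv))
      advance a (suc b) inv |D| |P| = search a b inv |D| |P|

theorem2p1 : ∀ {n} (G G' : Graph n) → G' ⊆G G → (s₁ s₂ ℓ : ℕ) → 1 ≤ s₁ → 1 ≤ s₂ → 1 ≤ ℓ
    → (∀ (S : Subset n) → ∣ S ∣ < s₁ + s₂ + ℓ → edgesIn G S < 2 * s₂)
    → (∀ (S : Subset n) → ∣ S ∣ ≡ s₁ → ∣ nbhd G' S ∣ ≥ s₂ + ℓ)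
    → n ≥ ℓ + s₁ + s₂
    → Σ (Fin (suc ℓ) → Fin n) (λ p → IsPath G' ℓ p × IsInducedIn G ℓ p)
theorem2p1 G G' G'⊆G zero s₂ ℓ () _ _ _ _ _
theorem2p1 {n} G G' G'⊆G (suc a) s₂ ℓ _ _ _ sparse expanding n≥ℓ+s₁+s₂ =
  search (suc a) s₂ ℓ s₁≤n sparse expanding a ℓ initial (cong (_+ suc a) (count-∅ n)) refl
  where
  open DepthFirstSearch G G' G'⊆G
  s₁≤n : suc a ≤ n
  s₁≤n = ≤-trans (m≤n+m (suc a) ℓ) (≤-trans (m≤m+n (ℓ + suc a) s₂) n≥ℓ+s₁+s₂)
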